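{- In any layer $L_i$ of $A_n$ there do not exist four consecutive nonempty rows $s,s+1,s+2,s+3$ whose lengths satisfy $\ell_s=\ell_{s+1}+2=\ell_{s+2}+4=\ell_{s+3}+6$ (i.e. lengths each increased by two going upward).
   Context: For $n\ge1$ and $A_n=(a_1,\dots,a_n)$, for each $i\le n$ divisible by neither 2 nor 3 the layer $L_i$ is $\{a_{i2^k3^s}:k,s\ge0,\ i2^k3^s\le n\}$, with $a_{i2^k3^s}$ placed in row $s$, column $k$. Row $s$ consists of the elements $a_{i3^s2^k}$ with $i3^s2^k\le n$, and $\ell_s$ denotes its number of elements. -}

module Defs where

open import Data.Nat using (ℕ; suc; _*_; _^_; _≤?_)
open import Data.List using (List; length; filter; upTo)

-- Row s of layer L_i of A_n consists of the entries a_{i·3^s·2^k} (k ≥ 0)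
-- with i·3^s·2^k ≤ n.  For i ≥ 1 and k > n we have i·3^s·2^k ≥ 2^k > n, so it
-- suffices to count k ∈ {0,…,n}.
rowLength : (n i s : ℕ) → ℕ
rowLength n i s = length (filter (λ k → i * 3 ^ s * 2 ^ k ≤? n) (upTo (suc n)))

{-# OPTIONS --safe #-}
module Submission where

-- The length ℓ_s of row s is the least k with i·3^s·2^k > n.  Hence
-- i·3^(s+3)·2^ℓ_{s+3} > n, and since 3^3 < 2^5 also i·3^s·2^(ℓ_{s+3}+5) > n,
-- i.e. ℓ_s ≤ ℓ_{s+3} + 5.  The forbidden pattern would give ℓ_s = ℓ_{s+3} + 6.

open import Defs
open import Data.Nat using (ℕ; zero; suc; _+_; _*_; _^_; _≤_; _<_; _≤′_; _≤?_; z≤n; z<s; s≤s)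
open import Data.Nat.Base using (≤′-refl; ≤′-step)
open import Data.Nat.Properties
open import Data.Nat.Divisibility using (_∣_)
open import Data.Product using (_×_; _,_)
open import Data.List using ([_]; _++_; length; filter; upTo)
open import Data.List.Properties using (upTo-∷ʳ; filter-++; filter-accept; filter-reject; length-++; length-filter; length-upTo)
open import Function using (_∘_)
open import Level using (Level)
open import Relation.Nullary using (¬_; yes; no)
open import Relation.Unary using (Pred; Decidable)
open import Relation.Binary.PropositionalEquality using (_≡_; refl; sym; trans; cong; subst; module ≡-Reasoning)

n<2^n : ∀ n → n < 2 ^ n
n<2^n zero    = z<s
n<2^n (suc n) = begin
  suc (suc n)       ≡⟨ +-comm 1 (suc n) ⟩
  suc n + 1         ≤⟨ +-mono-≤ (n<2^n n) (m^n>0 2 n) ⟩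
  2 ^ n + 2 ^ n     ≡⟨ cong (2 ^ n +_) (+-identityʳ (2 ^ n)) ⟨
  2 ^ suc n         ∎
  where open ≤-Reasoning

module Count {p : Level} {P : Pred ℕ p} (P? : Decidable P) where

  count : ℕ → ℕ
  count N = length (filter P? (upTo N))

  count≤ : ∀ N → count N ≤ N
  count≤ N = subst (count N ≤_) (length-upTo N) (length-filter P? (upTo N))

  count-suc : ∀ N → count (suc N) ≡ count N + length (filter P? [ N ])
  count-suc N = begin
    length (filter P? (upTo (suc N)))               ≡⟨ cong (length ∘ filter P?) (upTo-∷ʳ N) ⟨
    length (filter P? (upTo N ++ [ N ]))            ≡⟨ cong length (filter-++ P? (upTo N) [ N ]) ⟩
    length (filter P? (upTo N) ++ filter P? [ N ])  ≡⟨ length-++ (filter P? (upTo N)) ⟩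
    count N + length (filter P? [ N ])              ∎
    where open ≡-Reasoning

  count-suc-accept : ∀ {N} → P N → count (suc N) ≡ suc (count N)
  count-suc-accept {N} pN = begin
    count (suc N)                       ≡⟨ count-suc N ⟩
    count N + length (filter P? [ N ])  ≡⟨ cong (λ xs → count N + length xs) (filter-accept P? pN) ⟩
    count N + 1                         ≡⟨ +-comm (count N) 1 ⟩
    suc (count N)                       ∎
    where open ≡-Reasoning

  count-suc-reject : ∀ {N} → ¬ P N → count (suc N) ≡ count N
  count-suc-reject {N} ¬pN = begin
    count (suc N)                       ≡⟨ count-suc N ⟩
    count N + length (filter P? [ N ])  ≡⟨ cong (λ xs → count N + length xs) (filter-reject P? ¬pN) ⟩
    count N + 0                         ≡⟨ +-identityʳ (count N) ⟩
    count N                             ∎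
    where open ≡-Reasoning

  count-mono : ∀ {M N} → M ≤′ N → count M ≤ count N
  count-mono ≤′-refl         = ≤-refl
  count-mono (≤′-step {N} p) = ≤-trans (count-mono p)
    (subst (count N ≤_) (sym (count-suc N)) (m≤m+n (count N) _))

  module _ (P-downward : ∀ {j k} → j ≤ k → P k → P j) where

    P⇒count-suc≡suc : ∀ {j} → P j → count (suc j) ≡ suc j
    P⇒count-suc≡suc {zero}  pj = count-suc-accept pj
    P⇒count-suc≡suc {suc j} pj = trans (count-suc-accept pj)
      (cong suc (P⇒count-suc≡suc (P-downward (n≤1+n j) pj)))

    P⇒<count : ∀ {j N} → P j → j < N → j < count N
    P⇒<count {j} pj j<N = subst (_≤ _) (P⇒count-suc≡suc pj) (count-mono (≤⇒≤′ j<N))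

    ¬P⇒count≤ : ∀ {j} → ¬ P j → ∀ N → count N ≤ j
    ¬P⇒count≤ ¬pj zero = z≤n
    ¬P⇒count≤ {j} ¬pj (suc N) with P? N
    ... | yes pN = subst (_≤ j) (sym (count-suc-accept pN))
            (≤-trans (s≤s (count≤ N)) (≰⇒> (λ j≤N → ¬pj (P-downward j≤N pN))))
    ... | no ¬pN = subst (_≤ j) (sym (count-suc-reject ¬pN)) (¬P⇒count≤ ¬pj N)

module _ (n i s : ℕ) where

  Fits : ℕ → Set
  Fits k = i * 3 ^ s * 2 ^ k ≤ n

  Fits-downward : ∀ {j k} → j ≤ k → Fits k → Fits j
  Fits-downward j≤k = ≤-trans (*-monoʳ-≤ (i * 3 ^ s) (^-monoʳ-≤ 2 j≤k))

  open Count (λ k → i * 3 ^ s * 2 ^ k ≤? n)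

  rowLength≤ : ∀ {j} → ¬ Fits j → rowLength n i s ≤ j
  rowLength≤ ¬fits = ¬P⇒count≤ Fits-downward ¬fits (suc n)

  <rowLength : 1 ≤ i → ∀ {j} → Fits j → j < rowLength n i s
  <rowLength 1≤i {j} fits = P⇒<count Fits-downward fits (m<n⇒m<1+n (begin-strict
    j                  <⟨ n<2^n j ⟩
    2 ^ j              ≡⟨ *-identityˡ (2 ^ j) ⟨
    1 * 2 ^ j          ≤⟨ *-monoˡ-≤ (2 ^ j) (*-mono-≤ 1≤i (m^n>0 3 s)) ⟩
    i * 3 ^ s * 2 ^ j  ≤⟨ fits ⟩
    n                  ∎))
    where open ≤-Reasoning

  ¬Fits-rowLength : 1 ≤ i → ¬ Fits (rowLength n i s)
  ¬Fits-rowLength 1≤i fits = n≮n _ (<rowLength 1≤i fits)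

rowLength≤5+rowLength[s+3] : ∀ n i s → 1 ≤ i → rowLength n i s ≤ 5 + rowLength n i (s + 3)
rowLength≤5+rowLength[s+3] n i s 1≤i = rowLength≤ n i s (λ fits →
  ¬Fits-rowLength n i (s + 3) 1≤i (≤-trans shift fits))
  where
  L : ℕ
  L = rowLength n i (s + 3)
  shift : i * 3 ^ (s + 3) * 2 ^ L ≤ i * 3 ^ s * 2 ^ (5 + L)
  shift = begin
    i * 3 ^ (s + 3) * 2 ^ L     ≡⟨ cong (λ t → i * t * 2 ^ L) (^-distribˡ-+-* 3 s 3) ⟩
    i * (3 ^ s * 27) * 2 ^ L    ≡⟨ cong (_* 2 ^ L) (*-assoc i (3 ^ s) 27) ⟨
    i * 3 ^ s * 27 * 2 ^ L      ≤⟨ *-monoˡ-≤ (2 ^ L) (*-monoʳ-≤ (i * 3 ^ s) (m≤m+n 27 5)) ⟩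
    i * 3 ^ s * 32 * 2 ^ L      ≡⟨ *-assoc (i * 3 ^ s) 32 (2 ^ L) ⟩
    i * 3 ^ s * (32 * 2 ^ L)    ≡⟨ cong (i * 3 ^ s *_) (^-distribˡ-+-* 2 5 L) ⟨
    i * 3 ^ s * 2 ^ (5 + L)     ∎
    where open ≤-Reasoning

lemmaC1 : (n i s : ℕ) → 1 ≤ n → 1 ≤ i → i ≤ n → ¬ (2 ∣ i) → ¬ (3 ∣ i) →
    0 < rowLength n i s → 0 < rowLength n i (s + 1) →
    0 < rowLength n i (s + 2) → 0 < rowLength n i (s + 3) →
    ¬ ((rowLength n i s ≡ rowLength n i (s + 1) + 2)
    × (rowLength n i (s + 1) + 2 ≡ rowLength n i (s + 2) + 4)
    × (rowLength n i (s + 2) + 4 ≡ rowLength n i (s + 3) + 6))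
lemmaC1 n i s _ 1≤i _ _ _ _ _ _ _ (e₁ , e₂ , e₃) =
  n≮n (5 + L) (subst (_≤ 5 + L) ℓs≡6+L (rowLength≤5+rowLength[s+3] n i s 1≤i))
  where
  L : ℕ
  L = rowLength n i (s + 3)
  ℓs≡6+L : rowLength n i s ≡ 6 + L
  ℓs≡6+L = trans e₁ (trans e₂ (trans e₃ (+-comm L 6)))
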